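{- Let $G$ be a finite $(X,Y)$-bigraph (a bipartite graph with partite sets $X$ and $Y$) and let $S \subseteq X$ with $|S| < |X|-1$. Construct bipartite graphs $G_1, G_2$ with partite sets $X,Y$ as follows: $V(G_1)=V(G_2)=V(G)$, $E(G_1)=E(G)$, and $E(G_2)=E(G)\cup\{xy : x\in X\setminus S,\ y\in Y\}$. Then $G$ has an $S$-pair if and only if there are matchings $M_1\subseteq E(G_1)$ and $M_2\subseteq E(G_2)$ with $M_1\cap M_2=\emptyset$ such that each of $M_1$ and $M_2$ saturates $X$.
   Context: A matching is a set of pairwise disjoint edges; it saturates a vertex set $T$ if every vertex of $T$ lies in some edge of the matching. Given an $(X,Y)$-bigraph $G$ and $S\subseteq X$, an $S$-pair is a pair $(M_1,M_2)$ of matchings in $G$ with $M_1\cap M_2=\emptyset$ (no common edge), $M_1$ saturating $X$, and $M_2$ saturating $S$. -}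

module Defs where

open import Data.Nat using (ℕ)
open import Data.Fin using (Fin)
open import Data.Fin.Subset using (Subset; _∈_)
open import Data.Bool using (Bool; true; false; _∨_; not)
open import Data.Vec using (lookup)
open import Data.Product using (∃; _×_)
open import Relation.Binary.PropositionalEquality using (_≡_)
open import Relation.Nullary using (¬_)

-- A finite (X,Y)-bigraph with X = Fin m, Y = Fin n, given by its edge set:
-- the edge xy is present iff E x y ≡ true.  (Parallel edges do not arise
-- in a simple bipartite graph.)
EdgeSet : ℕ → ℕ → Set
EdgeSet m n = Fin m → Fin n → Bool

_⊆ₑ_ : ∀ {m n} → EdgeSet m n → EdgeSet m n → Set
M ⊆ₑ E = ∀ x y → M x y ≡ true → E x y ≡ true

IsMatching : ∀ {m n} → EdgeSet m n → Set
IsMatching M =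
  (∀ x y y′ → M x y ≡ true → M x y′ ≡ true → y ≡ y′) ×
  (∀ x x′ y → M x y ≡ true → M x′ y ≡ true → x ≡ x′)

MatchingIn : ∀ {m n} → EdgeSet m n → EdgeSet m n → Set
MatchingIn E M = (M ⊆ₑ E) × IsMatching M

Saturates : ∀ {m n} → EdgeSet m n → Subset m → Set
Saturates {m} {n} M T = ∀ (x : Fin m) → x ∈ T → ∃ λ (y : Fin n) → M x y ≡ true

SaturatesX : ∀ {m n} → EdgeSet m n → Set
SaturatesX {m} {n} M = ∀ (x : Fin m) → ∃ λ (y : Fin n) → M x y ≡ true

Disjoint : ∀ {m n} → EdgeSet m n → EdgeSet m n → Set
Disjoint M₁ M₂ = ∀ x y → ¬ (M₁ x y ≡ true × M₂ x y ≡ true)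

IsSPair : ∀ {m n} → EdgeSet m n → Subset m → EdgeSet m n → EdgeSet m n → Set
IsSPair E S M₁ M₂ =
  MatchingIn E M₁ × MatchingIn E M₂ × Disjoint M₁ M₂ × SaturatesX M₁ × Saturates M₂ S

HasSPair : ∀ {m n} → EdgeSet m n → Subset m → Set
HasSPair {m} {n} E S = ∃ λ (M₁ : EdgeSet m n) → ∃ λ (M₂ : EdgeSet m n) → IsSPair E S M₁ M₂

G₂Edges : ∀ {m n} → EdgeSet m n → Subset m → EdgeSet m n
G₂Edges E S x y = E x y ∨ not (lookup S x)

-- The backward direction restricts M₂ to S.  For the forward direction let f be
-- the partner function of M₁; it suffices to find an injection N : X → Y with
-- N x ≠ f x for all x that agrees with M₂ on S, since its graph lies in E(G₂).
-- Starting from M₂ on S, assign the vertices of X ∖ S one at a time to unused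
-- vertices of Y other than f x: as f is injective, |Y| ≥ |X|, so while two
-- vertices are unassigned there are two unused targets.  For the last vertex x
-- the only unused target may be f x; then another vertex a ∈ X ∖ S, which exists
-- as |S| < |X| - 1, is moved to f x and x takes the old target of a.
module Submission where

open import Defs
open import Data.Nat using (ℕ; zero; suc; _<_; _≤_; _∸_; s≤s)
import Data.Nat.Properties as ℕ
open import Data.Fin using (Fin; toℕ; fromℕ<; _≟_)
open import Data.Fin.Properties
  using (toℕ-injective; toℕ-fromℕ<; toℕ<n; punchOut-injective; injective⇒≤; any?; all?; ¬∀⟶∃¬)
open import Data.Fin.Subset using (Subset; _∈_; _∉_; ∣_∣; ⁅_⁆; ∁)
open import Data.Fin.Subset.Properties
  using (_∈?_; p⊆q⇒∣p∣≤∣q∣; ∣∁p∣≡n∸∣p∣; ∣⁅x⁆∣≡1; x∈∁p⇒x∉p; x∈⁅x⁆)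
open import Data.Vec using (lookup)
open import Data.Vec.Properties using ([]=⇒lookup; lookup⇒[]=)
open import Data.Vec.Functional using (updateAt)
open import Data.Vec.Functional.Properties using (updateAt-updates; updateAt-minimal)
open import Data.Bool using (true; false; _∧_; _∨_)
open import Data.Bool.Properties using (∧-conicalˡ; ∧-conicalʳ; ∨-identityʳ; ∨-zeroʳ)
open import Data.Product using (∃; _×_; _,_; proj₁; proj₂)
open import Data.Sum using (_⊎_; inj₁; inj₂; [_,_])
open import Level using (0ℓ)
open import Function using (const; _∘_)
open import Function.Definitions using (Injective)
open import Function.Bundles using (_⇔_; mk⇔)
open import Relation.Unary using (Pred; Decidable; _⊆_; _∪_; ｛_｝)
open import Relation.Unary.Properties using (_∪?_)
open import Relation.Nullary using (¬_; yes; no; does; ¬?; _×-dec_; _→-dec_; contradiction)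
open import Relation.Nullary.Decidable using (dec-true; decidable-stable)
open import Relation.Binary.PropositionalEquality using (_≡_; _≢_; refl; sym; trans; cong; cong₂; subst)

proper-cover⇒< : ∀ {m n} {D : Pred (Fin m) 0ℓ} {x} → ¬ D x → (P : Fin m → Fin n) →
                 (∀ y → ∃ λ z → D z × P z ≡ y) → n < m
proper-cover⇒< {suc _} {D = D} {x} x∉D P cover =
  s≤s (injective⇒≤ (λ eq → preimage-injective (punchOut-injective x≢ x≢ eq)))
  where
  preimage : _ → Fin _
  preimage y = proj₁ (cover y)
  preimage-injective : Injective _≡_ _≡_ preimage
  preimage-injective {y} {y′} eq =
    trans (sym (proj₂ (proj₂ (cover y)))) (trans (cong P eq) (proj₂ (proj₂ (cover y′))))
  x≢ : ∀ {y} → x ≢ preimage y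
  x≢ {y} refl = x∉D (proj₁ (proj₂ (cover y)))

module _ {m n : ℕ} where

  _[_]≔_ : (Fin m → Fin n) → Fin m → Fin n → Fin m → Fin n
  P [ x ]≔ y = updateAt P x (const y)

  update-view : ∀ P x y z → (x ≡ z × (P [ x ]≔ y) z ≡ y) ⊎ (x ≢ z × (P [ x ]≔ y) z ≡ P z)
  update-view P x y z with x ≟ z
  ... | yes refl = inj₁ (refl , updateAt-updates x P)
  ... | no x≢z = inj₂ (x≢z , updateAt-minimal z x P (x≢z ∘ sym))

  InjectiveOn : Pred (Fin m) 0ℓ → (Fin m → Fin n) → Set
  InjectiveOn D P = ∀ {z z′} → D z → D z′ → P z ≡ P z′ → z ≡ z′

  Unused : Pred (Fin m) 0ℓ → (Fin m → Fin n) → Fin n → Set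
  Unused D P y = ∀ {z} → D z → P z ≢ y

  ∃-unused : m ≤ n → ∀ {D} → Decidable D → ∀ {x} → ¬ D x → (P : Fin m → Fin n) →
             ∃ (Unused D P)
  ∃-unused m≤n {D} D? x∉D P with any? (λ y → all? λ z → D? z →-dec ¬? (P z ≟ y))
  ... | yes (y , unused) = y , λ {z} → unused z
  ... | no noneUnused = contradiction m≤n (ℕ.<⇒≱ (proper-cover⇒< x∉D P cover))
    where
    cover : ∀ y → ∃ λ z → D z × P z ≡ y
    cover y with ¬∀⟶∃¬ m _ (λ z → D? z →-dec ¬? (P z ≟ y)) (λ unused → noneUnused (y , unused))
    ... | z , used = z , decidable-stable (D? z) (λ z∉D → used (λ z∈D → contradiction z∈D z∉D))
                       , decidable-stable (P z ≟ y) (λ Pz≢y → used (const Pz≢y))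

  -- Reserve the target w for an auxiliary second unassigned vertex x′.
  ∃-unused-≢ : m ≤ n → ∀ {D} → Decidable D → ∀ {x x′} → ¬ D x → ¬ D x′ → x′ ≢ x →
               (P : Fin m → Fin n) (w : Fin n) → ∃ λ y → Unused D P y × y ≢ w
  ∃-unused-≢ m≤n {D} D? {x} {x′} x∉D x′∉D x′≢x P w
    with ∃-unused m≤n (D? ∪? (x′ ≟_)) [ x∉D , x′≢x ] (P [ x′ ]≔ w)
  ... | y , unused = y , unusedByP , λ y≡w → unused (inj₂ refl) (trans reserved (sym y≡w))
    where
    reserved : (P [ x′ ]≔ w) x′ ≡ w
    reserved = updateAt-updates x′ P
    unusedByP : Unused D P y
    unusedByP {z} z∈D with update-view P x′ w z
    ... | inj₁ (refl , _) = contradiction z∈D x′∉D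
    ... | inj₂ (_ , Pz) = unused (inj₁ z∈D) ∘ trans Pz

  unused-after-update : ∀ {D P y a} → InjectiveOn D P → Unused D P y → D a →
                        Unused D (P [ a ]≔ y) (P a)
  unused-after-update {D} {P} {y} {a} injective unused a∈D {z} z∈D with update-view P a y z
  ... | inj₁ (refl , Pz) = unused a∈D ∘ sym ∘ trans (sym Pz)
  ... | inj₂ (a≢z , Pz) = a≢z ∘ sym ∘ injective z∈D a∈D ∘ trans (sym Pz)

∃-∉-≢ : ∀ {m} {S : Subset m} → ∣ S ∣ < m ∸ 1 → ∀ x → ∃ λ a → a ∉ S × a ≢ x
∃-∉-≢ {m} {S} |S|<m-1 x with any? (λ a → ¬? (a ∈? S) ×-dec ¬? (a ≟ x))
... | yes found = found
... | no none = contradiction |S|<m-1 (ℕ.≤⇒≯ (begin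
    m ∸ 1           ≡⟨ cong (m ∸_) (sym (∣⁅x⁆∣≡1 x)) ⟩
    m ∸ ∣ ⁅ x ⁆ ∣   ≡⟨ sym (∣∁p∣≡n∸∣p∣ ⁅ x ⁆) ⟩
    ∣ ∁ ⁅ x ⁆ ∣     ≤⟨ p⊆q⇒∣p∣≤∣q∣ ∁⁅x⁆⊆S ⟩
    ∣ S ∣           ∎))
  where
  open ℕ.≤-Reasoning
  ∁⁅x⁆⊆S : ∀ {a} → a ∈ ∁ ⁅ x ⁆ → a ∈ S
  ∁⁅x⁆⊆S {a} a∈∁ = decidable-stable (a ∈? S)
    (λ a∉S → none (a , a∉S , λ { refl → x∈∁p⇒x∉p a∈∁ (x∈⁅x⁆ a) }))

module AvoidingInjection
  {m n : ℕ} (f : Fin m → Fin n) (f-injective : Injective _≡_ _≡_ f)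
  (S : Subset m) (|S|<m-1 : ∣ S ∣ < m ∸ 1)
  (Q : Fin m → Fin n → Set)
  (Q-injective : ∀ x x′ y → Q x y → Q x′ y → x ≡ x′)
  (Q-avoids : ∀ x y → Q x y → y ≢ f x)
  (Q-total : ∀ x → x ∈ S → ∃ (Q x))
  where

  m≤n : m ≤ n
  m≤n = injective⇒≤ f-injective

  record PartialSolution (D : Pred (Fin m) 0ℓ) (P : Fin m → Fin n) : Set where
    field
      injective : InjectiveOn D P
      avoids : ∀ {z} → D z → P z ≢ f z
      respects : ∀ {z} → z ∈ S → Q z (P z)

  PartialSolution-⊆ : ∀ {D D′ P} → D′ ⊆ D → PartialSolution D P → PartialSolution D′ P
  PartialSolution-⊆ D′⊆D good = record
    { injective = λ z∈ z′∈ → injective (D′⊆D z∈) (D′⊆D z′∈)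
    ; avoids = avoids ∘ D′⊆D
    ; respects = respects }
    where open PartialSolution good

  extend : ∀ {D P x y} → PartialSolution D P → Unused D P y → y ≢ f x → x ∉ S →
           PartialSolution (D ∪ ｛ x ｝) (P [ x ]≔ y)
  extend {D} {P} {x} {y} good unused y≢fx x∉S = record
    { injective = injective′ ; avoids = avoids′ ; respects = respects′ }
    where
    open PartialSolution good
    old : ∀ {z} → x ≢ z → (D ∪ ｛ x ｝) z → D z
    old x≢z = [ (λ z∈D → z∈D) , (λ x≡z → contradiction x≡z x≢z) ]
    injective′ : InjectiveOn (D ∪ ｛ x ｝) (P [ x ]≔ y)
    injective′ {z} {z′} z∈ z′∈ eq with update-view P x y z | update-view P x y z′
    ... | inj₁ (refl , _) | inj₁ (refl , _) = refl
    ... | inj₁ (refl , Pz) | inj₂ (x≢z′ , Pz′) =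
      contradiction (trans (sym Pz′) (trans (sym eq) Pz)) (unused (old x≢z′ z′∈))
    ... | inj₂ (x≢z , Pz) | inj₁ (refl , Pz′) =
      contradiction (trans (sym Pz) (trans eq Pz′)) (unused (old x≢z z∈))
    ... | inj₂ (x≢z , Pz) | inj₂ (x≢z′ , Pz′) =
      injective (old x≢z z∈) (old x≢z′ z′∈) (trans (sym Pz) (trans eq Pz′))
    avoids′ : ∀ {z} → (D ∪ ｛ x ｝) z → (P [ x ]≔ y) z ≢ f z
    avoids′ {z} z∈ with update-view P x y z
    ... | inj₁ (refl , Pz) = y≢fx ∘ trans (sym Pz)
    ... | inj₂ (x≢z , Pz) = avoids (old x≢z z∈) ∘ trans (sym Pz)
    respects′ : ∀ {z} → z ∈ S → Q z ((P [ x ]≔ y) z)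
    respects′ {z} z∈S with update-view P x y z
    ... | inj₁ (refl , _) = contradiction z∈S x∉S
    ... | inj₂ (_ , Pz) = subst (Q z) (sym Pz) (respects z∈S)

  -- Move a to f x, which is unused, and give x the old target of a.
  exchange : ∀ {D P x a} → PartialSolution D P → Unused D P (f x) → D a → a ∉ S → a ≢ x →
             x ∉ S → ∃ (PartialSolution (D ∪ ｛ x ｝))
  exchange {D} {P} {x} {a} good unused a∈D a∉S a≢x x∉S =
    _ , extend moved (unused-after-update (PartialSolution.injective good) unused a∈D)
               (unused a∈D) x∉S
    where
    moved : PartialSolution D (P [ a ]≔ f x)
    moved = PartialSolution-⊆ inj₁ (extend good unused (a≢x ∘ f-injective ∘ sym) a∉S)

  grow : ∀ {D P x} → Decidable D → PartialSolution D P → ¬ D x → x ∉ S →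
         ∃ (PartialSolution (D ∪ ｛ x ｝))
  grow {D} {P} {x} D? good x∉D x∉S with any? (λ w → ¬? (D? w) ×-dec ¬? (w ≟ x))
  ... | yes (w , w∉D , w≢x) with ∃-unused-≢ m≤n D? x∉D w∉D w≢x P (f x)
  ...   | y , unused , y≢fx = _ , extend good unused y≢fx x∉S
  grow {D} {P} {x} D? good x∉D x∉S | no othersAssigned with ∃-unused m≤n D? x∉D P
  ... | y , unused with y ≟ f x
  ...   | no y≢fx = _ , extend good unused y≢fx x∉S
  ...   | yes refl with ∃-∉-≢ |S|<m-1 x
  ...     | a , a∉S , a≢x = exchange good unused a∈D a∉S a≢x x∉S
    where
    a∈D : D a
    a∈D = decidable-stable (D? a) (λ a∉D → othersAssigned (a , a∉D , a≢x))

  Done : ℕ → Pred (Fin m) 0ℓ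
  Done k z = z ∈ S ⊎ toℕ z < k

  Done? : ∀ k → Decidable (Done k)
  Done? k = (_∈? S) ∪? (λ z → toℕ z ℕ.<? k)

  Done-suc : ∀ {k} (k<m : k < m) → Done (suc k) ⊆ Done k ∪ ｛ fromℕ< k<m ｝
  Done-suc k<m (inj₁ z∈S) = inj₁ (inj₁ z∈S)
  Done-suc k<m (inj₂ z<1+k) with ℕ.m<1+n⇒m<n∨m≡n z<1+k
  ... | inj₁ z<k = inj₁ (inj₂ z<k)
  ... | inj₂ z≡k = inj₂ (toℕ-injective (trans (toℕ-fromℕ< k<m) (sym z≡k)))

  initial : Fin m → Fin n
  initial z with z ∈? S
  ... | yes z∈S = proj₁ (Q-total z z∈S)
  ... | no _ = f z

  initial-respects : ∀ {z} → z ∈ S → Q z (initial z)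
  initial-respects {z} z∈S with z ∈? S
  ... | yes z∈S′ = proj₂ (Q-total z z∈S′)
  ... | no z∉S = contradiction z∈S z∉S

  PartialSolution-initial : PartialSolution (Done 0) initial
  PartialSolution-initial = record
    { injective = λ { (inj₁ z∈S) (inj₁ z′∈S) eq →
        Q-injective _ _ _ (initial-respects z∈S) (subst (Q _) (sym eq) (initial-respects z′∈S)) }
    ; avoids = λ { (inj₁ z∈S) → Q-avoids _ _ (initial-respects z∈S) }
    ; respects = initial-respects }

  solution-upTo : ∀ k → k ≤ m → ∃ (PartialSolution (Done k))
  solution-upTo zero _ = initial , PartialSolution-initial
  solution-upTo (suc k) k<m with solution-upTo k (ℕ.<⇒≤ k<m) | fromℕ< k<m ∈? S
  ... | P , good | yes x∈S =
    P , PartialSolution-⊆ ([ (λ z∈D → z∈D) , (λ { refl → inj₁ x∈S }) ] ∘ Done-suc k<m) good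
  ... | P , good | no x∉S with grow (Done? k) good x∉Done x∉S
    where
    x∉Done : ¬ Done k (fromℕ< k<m)
    x∉Done = [ x∉S , ℕ.<-irrefl (toℕ-fromℕ< k<m) ]
  ...   | P′ , good′ = P′ , PartialSolution-⊆ (Done-suc k<m) good′

  ∃-avoiding-injection : ∃ λ N → Injective _≡_ _≡_ N × (∀ x → N x ≢ f x) × (∀ x → x ∈ S → Q x (N x))
  ∃-avoiding-injection with solution-upTo m ℕ.≤-refl
  ... | N , good = N , injective (all _) (all _) , (λ x → avoids (all x)) , (λ x → respects)
    where
    open PartialSolution good
    all : ∀ x → Done m x
    all x = inj₂ (toℕ<n x)

module _ {m n : ℕ} where

  partner : {M : EdgeSet m n} → SaturatesX M → Fin m → Fin n
  partner sat x = proj₁ (sat x)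

  partner-injective : ∀ {M} → IsMatching M → (sat : SaturatesX M) → Injective _≡_ _≡_ (partner sat)
  partner-injective {M} (_ , unique-x) sat {x} {x′} eq =
    unique-x x x′ _ (subst (λ y → M x y ≡ true) eq (proj₂ (sat x))) (proj₂ (sat x′))

  graph : (Fin m → Fin n) → EdgeSet m n
  graph N x y = does (y ≟ N x)

  graph-sound : ∀ N x y → graph N x y ≡ true → y ≡ N x
  graph-sound N x y eq with y ≟ N x
  ... | yes y≡Nx = y≡Nx

  graph-complete : ∀ N x → graph N x (N x) ≡ true
  graph-complete N x = dec-true (N x ≟ N x) refl

  graph-isMatching : ∀ {N} → Injective _≡_ _≡_ N → IsMatching (graph N)
  graph-isMatching {N} N-injective =
    (λ x y y′ e e′ → trans (graph-sound N x y e) (sym (graph-sound N x y′ e′))) ,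
    (λ x x′ y e e′ → N-injective (trans (sym (graph-sound N x y e)) (graph-sound N x′ y e′)))

  graph-saturatesX : ∀ N → SaturatesX (graph N)
  graph-saturatesX N x = N x , graph-complete N x

  graph-⊆ : ∀ {N E} → (∀ x → E x (N x) ≡ true) → graph N ⊆ₑ E
  graph-⊆ {N} {E} N∈E x y e = subst (λ y → E x y ≡ true) (sym (graph-sound N x y e)) (N∈E x)

  graph-disjoint : ∀ {N M} → (∀ x → M x (N x) ≢ true) → Disjoint M (graph N)
  graph-disjoint {N} {M} N∉M x y (e , e′) =
    N∉M x (subst (λ y → M x y ≡ true) (graph-sound N x y e′) e)

  restrictTo : EdgeSet m n → Subset m → EdgeSet m n
  restrictTo M S x y = M x y ∧ lookup S x

  restrictTo-⊆ : ∀ {M} S → restrictTo M S ⊆ₑ M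
  restrictTo-⊆ {M} S x y = ∧-conicalˡ (M x y) (lookup S x)

  isMatching-⊆ : ∀ {M M′ : EdgeSet m n} → M′ ⊆ₑ M → IsMatching M → IsMatching M′
  isMatching-⊆ M′⊆M (unique-y , unique-x) =
    (λ x y y′ e e′ → unique-y x y y′ (M′⊆M x y e) (M′⊆M x y′ e′)) ,
    (λ x x′ y e e′ → unique-x x x′ y (M′⊆M x y e) (M′⊆M x′ y e′))

  disjoint-⊆ : ∀ {M₁ M₂ M₂′ : EdgeSet m n} → M₂′ ⊆ₑ M₂ → Disjoint M₁ M₂ → Disjoint M₁ M₂′
  disjoint-⊆ M₂′⊆M₂ disjoint x y (e₁ , e₂) = disjoint x y (e₁ , M₂′⊆M₂ x y e₂)

  restrictTo-saturates : ∀ {M} S → SaturatesX M → Saturates (restrictTo M S) S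
  restrictTo-saturates S sat x x∈S = partner sat x , cong₂ _∧_ (proj₂ (sat x)) ([]=⇒lookup x∈S)

  restrictTo-G₂Edges-⊆ : ∀ {E M} S → M ⊆ₑ G₂Edges E S → restrictTo M S ⊆ₑ E
  restrictTo-G₂Edges-⊆ {E} {M} S M⊆G₂ x y e
    with M⊆G₂ x y (restrictTo-⊆ {M} S x y e) | ∧-conicalʳ (M x y) (lookup S x) e
  ... | e′ | x∈S rewrite x∈S | ∨-identityʳ (E x y) = e′

  ∈-G₂Edges : ∀ {E : EdgeSet m n} {S x y} → (x ∈ S → E x y ≡ true) → G₂Edges E S x y ≡ true
  ∈-G₂Edges {E} {S} {x} {y} E-on-S with lookup S x in S[x]
  ... | true = cong (_∨ false) (E-on-S (lookup⇒[]= x S S[x]))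
  ... | false = ∨-zeroʳ (E x y)

HasSaturatingPair : ∀ {m n} → EdgeSet m n → EdgeSet m n → Set
HasSaturatingPair {m} {n} E₁ E₂ = ∃ λ (M₁ : EdgeSet m n) → ∃ λ (M₂ : EdgeSet m n) →
  MatchingIn E₁ M₁ × MatchingIn E₂ M₂ × Disjoint M₁ M₂ × SaturatesX M₁ × SaturatesX M₂

SPair⇒saturatingPair : ∀ {m n} {E : EdgeSet m n} {S} → ∣ S ∣ < m ∸ 1 →
                       HasSPair E S → HasSaturatingPair E (G₂Edges E S)
SPair⇒saturatingPair {E = E} {S} |S|<m-1
  (M₁ , M₂ , M₁∈E@(_ , M₁-matching) , (M₂⊆E , M₂-matching) , disjoint , M₁-saturates , M₂-saturates)
  with AvoidingInjection.∃-avoiding-injection f (partner-injective M₁-matching M₁-saturates) S |S|<m-1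
         (λ x y → M₂ x y ≡ true) (proj₂ M₂-matching) M₂-avoids M₂-saturates
  where
  f = partner M₁-saturates
  M₂-avoids : ∀ x y → M₂ x y ≡ true → y ≢ f x
  M₂-avoids x y e refl = disjoint x y (proj₂ (M₁-saturates x) , e)
... | N , N-injective , N≢f , N∈M₂ =
  M₁ , graph N , M₁∈E , (graph-⊆ N∈G₂ , graph-isMatching N-injective) ,
  graph-disjoint N∉M₁ , M₁-saturates , graph-saturatesX N
  where
  N∈G₂ : ∀ x → G₂Edges E S x (N x) ≡ true
  N∈G₂ x = ∈-G₂Edges {E = E} {S} (M₂⊆E x (N x) ∘ N∈M₂ x)
  N∉M₁ : ∀ x → M₁ x (N x) ≢ true
  N∉M₁ x e = N≢f x (proj₁ M₁-matching x _ _ e (proj₂ (M₁-saturates x)))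

saturatingPair⇒SPair : ∀ {m n} {E : EdgeSet m n} {S} →
                       HasSaturatingPair E (G₂Edges E S) → HasSPair E S
saturatingPair⇒SPair {S = S}
  (M₁ , M₂ , M₁∈E , (M₂⊆G₂ , M₂-matching) , disjoint , M₁-saturates , M₂-saturates) =
  M₁ , restrictTo M₂ S , M₁∈E ,
  (restrictTo-G₂Edges-⊆ S M₂⊆G₂ , isMatching-⊆ (restrictTo-⊆ S) M₂-matching) ,
  disjoint-⊆ (restrictTo-⊆ S) disjoint , M₁-saturates , restrictTo-saturates S M₂-saturates

mainTheorem1 : ∀ (m n : ℕ) (E : EdgeSet m n) (S : Subset m) → ∣ S ∣ < m ∸ 1 →
    HasSPair E S ⇔
      (∃ λ (M₁ : EdgeSet m n) → ∃ λ (M₂ : EdgeSet m n) →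
        MatchingIn E M₁ × MatchingIn (G₂Edges E S) M₂ × Disjoint M₁ M₂ ×
        SaturatesX M₁ × SaturatesX M₂)
mainTheorem1 m n E S |S|<m-1 = mk⇔ (SPair⇒saturatingPair |S|<m-1) saturatingPair⇒SPair
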